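{- Let $O$ be a locally finite totally ordered set and $A\in\mathscr E_O$. An interval $I\in\mathscr I^\infty_O$ is critical for $A$ if and only if one of the following holds: (i) $I=[\ell+1..r'-1]\ne\emptyset$ where $[\ell..r],[\ell'..r']\in A$ and $[\ell'..r']$ is the successor of $[\ell..r]$ in $A$; (ii) $I=(\leftarrow..r-1]\ne\emptyset$ where $[\ell..r]$ is the first element of $A$ for some $\ell$; (iii) $I=[\ell+1..\rightarrow)\ne\emptyset$ where $[\ell..r]$ is the last element of $A$ for some $r$; (iv) $I=O$ and $A=0$; (v) $I=\emptyset$ and $A=1^-$.
   Context: $O=(O,\sqsubseteq)$ is locally finite and totally ordered. Intervals are convex subsets (including $\emptyset$); $\mathscr I_O$ = finite intervals, $\mathscr I^\infty_O$ = all intervals. $[\ell..r]=\{x:\ell\sqsubseteq x\sqsubseteq r\}$, $(\leftarrow..r]=\{x:x\sqsubseteq r\}$, $[\ell..\rightarrow)=\{x:\ell\sqsubseteq x\}$; $x+1$, $x-1$ are successor and predecessor in $O$, with the convention $[\ell+1..\rightarrow)=\emptyset$ if $\ell$ has no successor and $(\leftarrow..r-1]=\emptyset$ if $r$ has no predecessor. $\mathscr E_O$ is the set of inclusion-antichains of elements of $\mathscr I_O$, ordered by $A\le B$ iff for every $I\in A$ there is $J\in B$ with $J\subseteq I$; $0=\emptyset$, $1^-=\{\{x\}:x\in O\}$. The nonempty intervals of an antichain are totally ordered by their left extremes (equivalently right extremes); successor, first and last elements of $A$ refer to this order. An interval $I\in\mathscr I^\infty_O$ is critical for $A$ if it contains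 no interval of $A$ and is inclusion-maximal among the intervals of $\mathscr I^\infty_O$ containing no interval of $A$. -}

module Defs where

open import Level using (0ℓ)
open import Data.Product using (Σ; ∃; ∃-syntax; _×_; _,_)
open import Data.List using (List)
open import Data.List.Membership.Propositional using (_∈_)
open import Relation.Nullary using (¬_)
open import Relation.Unary using (Pred; _⊆_; _≐_)
open import Relation.Binary.Core using (Rel)
open import Relation.Binary.Structures using (IsTotalOrder)
open import Relation.Binary.PropositionalEquality using (_≡_; _≢_)

record LFTO : Set₁ where
  field
    Carrier       : Set
    _⊑_           : Rel Carrier 0ℓ
    isTotalOrder  : IsTotalOrder _≡_ _⊑_
    locallyFinite : ∀ a b → ∃[ xs ] (∀ x → a ⊑ x → x ⊑ b → x ∈ xs)

module _ (O : LFTO) where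
  open LFTO O

  _⊏_ : Rel Carrier 0ℓ
  x ⊏ y = x ⊑ y × x ≢ y

  IsSucc : Carrier → Carrier → Set
  IsSucc x y = x ⊏ y × (∀ z → x ⊏ z → y ⊑ z)

  Subset : Set₁
  Subset = Pred Carrier 0ℓ

  -- intervals of O (elements of 𝓘^∞_O): convex subsets
  IsInterval : Subset → Set
  IsInterval I = ∀ x y z → I x → I z → x ⊑ y → y ⊑ z → I y

  [_‥_] : Carrier → Carrier → Subset
  [ l ‥ r ] x = l ⊑ x × x ⊑ r

  -- [ℓ+1..r-1]  (empty if ℓ has no successor or r has no predecessor)
  [_+1‥_-1] : Carrier → Carrier → Subset
  [ l +1‥ r -1] x = ∃[ s ] ∃[ p ] (IsSucc l s × IsSucc p r × s ⊑ x × x ⊑ p)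

  -- (←..r-1]  (empty if r has no predecessor)
  ⟨←‥_-1] : Carrier → Subset
  ⟨←‥ r -1] x = ∃[ p ] (IsSucc p r × x ⊑ p)

  -- [ℓ+1..→)  (empty if ℓ has no successor)
  [_+1‥→⟩ : Carrier → Subset
  [ l +1‥→⟩ x = ∃[ s ] (IsSucc l s × s ⊑ x)

  Whole : Subset
  Whole _ = Data.Unit.⊤ where import Data.Unit

  Empty : Subset
  Empty _ = Data.Empty.⊥ where import Data.Empty

  -- finite intervals (elements of 𝓘_O): ∅ or [ℓ..r]; well-formedness ℓ ⊑ r
  -- is imposed on the members of an antichain, making the representation canonical.
  data FinInt : Set where
    ∅ᶠ   : FinInt
    ⟦_,_⟧ : Carrier → Carrier → FinInt

  ⟪_⟫ : FinInt → Subset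
  ⟪ ∅ᶠ ⟫ = Empty
  ⟪ ⟦ l , r ⟧ ⟫ = [ l ‥ r ]

  -- elements of 𝓔_O: inclusion-antichains of finite intervals (possibly infinite)
  record Antichain : Set₁ where
    field
      _∈A        : FinInt → Set
      wellFormed : ∀ l r → ⟦ l , r ⟧ ∈A → l ⊑ r
      antichain  : ∀ I J → I ∈A → J ∈A → ⟪ I ⟫ ⊆ ⟪ J ⟫ → I ≡ J

  module _ (A : Antichain) where
    open Antichain A

    IsZero : Set
    IsZero = ∀ I → ¬ (I ∈A)

    IsOneMinus : Set
    IsOneMinus = ∀ I → (I ∈A → ∃[ x ] (I ≡ ⟦ x , x ⟧)) × (∀ x → I ≡ ⟦ x , x ⟧ → I ∈A)

    -- [ℓ'..r'] is the successor of [ℓ..r] in A (order by left extremes)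
    IsSuccIn : Carrier → Carrier → Carrier → Carrier → Set
    IsSuccIn l r l' r' =
      ⟦ l , r ⟧ ∈A × ⟦ l' , r' ⟧ ∈A × l ⊏ l' ×
      (∀ l'' r'' → ⟦ l'' , r'' ⟧ ∈A → ¬ (l ⊏ l'' × l'' ⊏ l'))

    IsFirst : Carrier → Carrier → Set
    IsFirst l r = ⟦ l , r ⟧ ∈A × (∀ l'' r'' → ⟦ l'' , r'' ⟧ ∈A → l ⊑ l'')

    IsLast : Carrier → Carrier → Set
    IsLast l r = ⟦ l , r ⟧ ∈A × (∀ l'' r'' → ⟦ l'' , r'' ⟧ ∈A → l'' ⊑ l)

    AvoidsA : Subset → Set
    AvoidsA I = ∀ J → J ∈A → ¬ (⟪ J ⟫ ⊆ I)

    Critical : Subset → Set₁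
    Critical I = IsInterval I × AvoidsA I ×
      (∀ I' → IsInterval I' → AvoidsA I' → I ⊆ I' → I' ⊆ I)

    NonEmpty : Subset → Set
    NonEmpty I = ∃[ x ] I x

    Case-i : Subset → Set
    Case-i I = ∃[ l ] ∃[ r ] ∃[ l' ] ∃[ r' ]
      (IsSuccIn l r l' r' × I ≐ [ l +1‥ r' -1] × NonEmpty I)

    Case-ii : Subset → Set
    Case-ii I = ∃[ l ] ∃[ r ] (IsFirst l r × I ≐ ⟨←‥ r -1] × NonEmpty I)

    Case-iii : Subset → Set
    Case-iii I = ∃[ l ] ∃[ r ] (IsLast l r × I ≐ [ l +1‥→⟩ × NonEmpty I)

    Case-iv : Subset → Set
    Case-iv I = I ≐ Whole × IsZero

    Case-v : Subset → Set
    Case-v I = I ≐ Empty × IsOneMinus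

-- With excluded middle, local finiteness turns every nonempty interval I into an open
-- interval (lo, hi) with ends in O ∪ {±∞}: lo is the greatest point outside I below a
-- given point of I, a maximum over a finite range; finiteness also provides the
-- successors and predecessors needed to write (lo, hi) as [lo+1..hi-1]. Such an interval
-- is critical iff it avoids A, a finite lo is the left extreme of a member of A ending
-- before hi, and a finite hi the right extreme of one starting after lo: enlarging I by
-- its end point must swallow a member of A, which then starts (or ends) exactly there.
-- Since the members of an antichain are ordered alike by left and right extremes, these
-- conditions are cases (i)–(iv); the empty interval is critical iff no singleton avoids
-- A, i.e. A = 1⁻.
module Submission where

open import Defs
open import Level using (0ℓ; suc; lift; lower)
open import Axiom.ExcludedMiddle using (ExcludedMiddle)
open import Data.Empty using (⊥-elim)
open import Data.Maybe using (Maybe; nothing; just)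
open import Data.Product using (∃-syntax; _×_; _,_; proj₁; proj₂)
open import Data.Sum using (_⊎_; inj₁; inj₂)
open import Data.Unit using (⊤; tt)
open import Data.List using (filter)
open import Data.List.Membership.Propositional using (_∈_)
open import Data.List.Membership.Propositional.Properties using (∈-filter⁺)
open import Data.List.Relation.Unary.All using (lookup)
open import Data.List.Relation.Unary.All.Properties using (all-filter)
open import Function using (id; _∘_)
open import Function.Bundles using (_⇔_; mk⇔; module Equivalence)
open import Relation.Binary.Bundles using (TotalOrder)
open import Relation.Binary.Structures using (IsTotalOrder)
open import Relation.Binary.PropositionalEquality using (_≡_; refl; sym; cong; subst; subst₂)
import Relation.Binary.Construct.NonStrictToStrict as ToStrict
open import Relation.Nullary using (¬_; yes; no)
open import Relation.Nullary.Decidable using (map′; decidable-stable)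
open import Relation.Unary using (_⊆_; _≐_; _∩_)
open import Relation.Unary.Properties using (≐-sym; ≐-trans)

module Intervals (O : LFTO) where
  open LFTO O
  open Equivalence using (to; from)
  open IsTotalOrder isTotalOrder
    using (total; antisym; ≤-respˡ-≈; ≤-respʳ-≈) renaming (refl to ⊑-refl; trans to ⊑-trans)

  totalOrder : TotalOrder 0ℓ 0ℓ 0ℓ
  totalOrder = record { isTotalOrder = isTotalOrder }

  open import Relation.Binary.Properties.TotalOrder totalOrder using (_<_; <-irrefl; <⇒≱; ≰⇒>)

  <-≤-trans : ∀ {x y z} → x < y → y ⊑ z → x < z
  <-≤-trans = ToStrict.<-≤-trans _≡_ _⊑_ sym ⊑-trans antisym ≤-respʳ-≈

  ≤-<-trans : ∀ {x y z} → x ⊑ y → y < z → x < z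
  ≤-<-trans = ToStrict.≤-<-trans _≡_ _⊑_ ⊑-trans antisym ≤-respˡ-≈

  -- Open lo hi is the set strictly between lo and hi, where nothing stands
  -- for −∞ as a lower end and for +∞ as an upper end.
  Above : Maybe Carrier → Subset O
  Above nothing  _ = ⊤
  Above (just l) z = l < z

  Below : Maybe Carrier → Subset O
  Below nothing  _ = ⊤
  Below (just r) z = z < r

  Open : Maybe Carrier → Maybe Carrier → Subset O
  Open lo hi = Above lo ∩ Below hi

  above-mono : ∀ {lo y z} → Above lo y → y ⊑ z → Above lo z
  above-mono {nothing} _   _   = tt
  above-mono {just _}  l<y y⊑z = <-≤-trans l<y y⊑z

  below-mono : ∀ {hi y z} → z ⊑ y → Below hi y → Below hi z
  below-mono {nothing} _   _   = tt
  below-mono {just _}  z⊑y y<r = ≤-<-trans z⊑y y<r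

  upClosed⇒interval : ∀ {P : Subset O} → (∀ {y z} → P y → y ⊑ z → P z) → IsInterval O P
  upClosed⇒interval up _ _ _ Px _ x⊑y _ = up Px x⊑y

  downClosed⇒interval : ∀ {P : Subset O} → (∀ {y z} → z ⊑ y → P y → P z) → IsInterval O P
  downClosed⇒interval down _ _ _ _ Pz _ y⊑z = down y⊑z Pz

  ∩-interval : ∀ {P Q : Subset O} → IsInterval O P → IsInterval O Q → IsInterval O (P ∩ Q)
  ∩-interval P-int Q-int x y z (Px , Qx) (Pz , Qz) x⊑y y⊑z =
    P-int x y z Px Pz x⊑y y⊑z , Q-int x y z Qx Qz x⊑y y⊑z

  open-interval : ∀ {lo hi} → IsInterval O (Open lo hi)
  open-interval = ∩-interval (upClosed⇒interval above-mono) (downClosed⇒interval below-mono)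

  [‥]-interval : ∀ {a b} → IsInterval O ([_‥_] O a b)
  [‥]-interval = ∩-interval (upClosed⇒interval ⊑-trans) (downClosed⇒interval ⊑-trans)

  [‥]⊆open : ∀ {lo hi a b} → Above lo a → Below hi b → [_‥_] O a b ⊆ Open lo hi
  [‥]⊆open lo<a b<hi (a⊑w , w⊑b) = above-mono lo<a a⊑w , below-mono w⊑b b<hi

  interval-resp-≐ : ∀ {P Q : Subset O} → P ≐ Q → IsInterval O P → IsInterval O Q
  interval-resp-≐ (P⊆Q , Q⊆P) P-int x y z Qx Qz x⊑y y⊑z =
    P⊆Q (P-int x y z (Q⊆P Qx) (Q⊆P Qz) x⊑y y⊑z)

  module Gaps (A : Antichain O) where
    open Antichain A

    -- Gap lo hi: lo is the left extreme of a member of A and hi the right extreme of a later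
    -- one (±∞ standing for no member), and no member of A lies strictly between them.
    LeftEnd : Maybe Carrier → Maybe Carrier → Set
    LeftEnd nothing  _  = ⊤
    LeftEnd (just l) hi = ∃[ r ] (⟦ l , r ⟧ ∈A × Below hi r)

    RightEnd : Maybe Carrier → Maybe Carrier → Set
    RightEnd _  nothing  = ⊤
    RightEnd lo (just r) = ∃[ l ] (⟦ l , r ⟧ ∈A × Above lo l)

    Gap : Maybe Carrier → Maybe Carrier → Set
    Gap lo hi = LeftEnd lo hi × RightEnd lo hi × AvoidsA O A (Open lo hi)

    critical-resp-≐ : ∀ {P Q : Subset O} → P ≐ Q → Critical O A P → Critical O A Q
    critical-resp-≐ P≐Q@(P⊆Q , Q⊆P) (P-int , P-avoids , P-maximal) =
      interval-resp-≐ P≐Q P-int ,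
      (λ J J∈A J⊆Q → P-avoids J J∈A (λ Jx → Q⊆P (J⊆Q Jx))) ,
      (λ I' I'-int I'-avoids Q⊆I' I'x →
        P⊆Q (P-maximal I' I'-int I'-avoids (λ Px → Q⊆I' (P⊆Q Px)) I'x))

    critical-whole : IsZero O A → Critical O A (Whole O)
    critical-whole zero = (λ _ _ _ _ _ _ _ → tt) , (λ J J∈A _ → zero J J∈A) , (λ _ _ _ _ _ → tt)

    avoids⇒∅ᶠ∉A : ∀ {S : Subset O} → AvoidsA O A S → ¬ (∅ᶠ ∈A)
    avoids⇒∅ᶠ∉A avoids ∅ᶠ∈A = avoids ∅ᶠ ∅ᶠ∈A (λ ())

    member⇒∅ᶠ∉A : ∀ {l r} → ⟦ l , r ⟧ ∈A → ¬ (∅ᶠ ∈A)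
    member⇒∅ᶠ∉A lr∈A ∅ᶠ∈A with antichain ∅ᶠ _ ∅ᶠ∈A lr∈A (λ ())
    ... | ()

    nested-≡ : ∀ {a b l r} → ⟦ a , b ⟧ ∈A → ⟦ l , r ⟧ ∈A → l ⊑ a → b ⊑ r → a ≡ l × b ≡ r
    nested-≡ ab∈A lr∈A l⊑a b⊑r
      with antichain _ _ ab∈A lr∈A (λ (a⊑w , w⊑b) → ⊑-trans l⊑a a⊑w , ⊑-trans w⊑b b⊑r)
    ... | refl = refl , refl

    member-ends : ∀ {a b} {S : Subset O} → ⟦ a , b ⟧ ∈A → [_‥_] O a b ⊆ S → S a × S b
    member-ends ab∈A ab⊆S =
      ab⊆S (⊑-refl , wellFormed _ _ ab∈A) , ab⊆S (wellFormed _ _ ab∈A , ⊑-refl)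

    avoids-open : ∀ {lo hi} → ¬ (∅ᶠ ∈A) →
                  (∀ {a b} → ⟦ a , b ⟧ ∈A → ¬ (Above lo a × Below hi b)) → AvoidsA O A (Open lo hi)
    avoids-open ∅ᶠ∉A _ ∅ᶠ ∅ᶠ∈A _ = ∅ᶠ∉A ∅ᶠ∈A
    avoids-open _ no-member ⟦ a , b ⟧ ab∈A ab⊆open with member-ends ab∈A ab⊆open
    ... | (lo<a , _) , (_ , b<hi) = no-member ab∈A (lo<a , b<hi)

    gap⇒isZero : Gap nothing nothing → IsZero O A
    gap⇒isZero (_ , _ , avoids) J J∈A = avoids J J∈A (λ _ → tt , tt)

  module Classical (em : ExcludedMiddle (suc 0ℓ)) where

    dec : ExcludedMiddle 0ℓ
    dec = map′ lower lift em

    ⊑⊎> : ∀ x y → x ⊑ y ⊎ y < x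
    ⊑⊎> x y with dec {x ⊑ y}
    ... | yes x⊑y = inj₁ x⊑y
    ... | no  x⋢y = inj₂ (≰⇒> x⋢y)

    ≡⊎< : ∀ {x y} → x ⊑ y → x ≡ y ⊎ x < y
    ≡⊎< {x} {y} x⊑y with dec {x ≡ y}
    ... | yes x≡y = inj₁ x≡y
    ... | no  x≢y = inj₂ (x⊑y , x≢y)

    module _ {Q : Subset O} {a b : Carrier} (bounded : ∀ {w} → Q w → a ⊑ w × w ⊑ b) where
      private
        Q? = λ w → dec {Q w}
        range = proj₁ (locallyFinite a b)
        candidates = filter Q? range
        candidate : ∀ {w} → Q w → w ∈ candidates
        candidate Qw =
          ∈-filter⁺ Q? (proj₂ (locallyFinite a b) _ (proj₁ (bounded Qw)) (proj₂ (bounded Qw))) Qw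

      greatest : ∀ {w₀} → Q w₀ → ∃[ y ] (Q y × (∀ {w} → Q w → w ⊑ y))
      greatest {w₀} Qw₀ =
        max w₀ candidates ,
        argmax-all id Qw₀ (all-filter Q? range) ,
        λ Qw → lookup (xs≤max w₀ candidates) (candidate Qw)
        where open import Data.List.Extrema totalOrder using (max; argmax-all; xs≤max)

      least : ∀ {w₀} → Q w₀ → ∃[ y ] (Q y × (∀ {w} → Q w → y ⊑ w))
      least {w₀} Qw₀ =
        min w₀ candidates ,
        argmin-all id Qw₀ (all-filter Q? range) ,
        λ Qw → lookup (min≤xs w₀ candidates) (candidate Qw)
        where open import Data.List.Extrema totalOrder using (min; argmin-all; min≤xs)

    succ-exists : ∀ {x y} → x < y → ∃[ s ] (IsSucc O x s × s ⊑ y)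
    succ-exists {x} {y} x<y
      with least {Q = λ w → x < w × w ⊑ y} (λ (x<w , w⊑y) → proj₁ x<w , w⊑y) (x<y , ⊑-refl)
    ... | s , (x<s , s⊑y) , minimal = s , (x<s , s⊑above) , s⊑y
      where
      s⊑above : ∀ z → x < z → s ⊑ z
      s⊑above z x<z with total z y
      ... | inj₁ z⊑y = minimal (x<z , z⊑y)
      ... | inj₂ y⊑z = ⊑-trans s⊑y y⊑z

    pred-exists : ∀ {x y} → y < x → ∃[ p ] (IsSucc O p x × y ⊑ p)
    pred-exists {x} {y} y<x
      with greatest {Q = λ w → y ⊑ w × w < x} (λ (y⊑w , w<x) → y⊑w , proj₁ w<x) (⊑-refl , y<x)
    ... | p , (y⊑p , p<x) , maximal = p , (p<x , x⊑above) , y⊑p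
      where
      x⊑above : ∀ z → p < z → x ⊑ z
      x⊑above z p<z with ⊑⊎> x z
      ... | inj₁ x⊑z = x⊑z
      ... | inj₂ z<x = ⊥-elim (<⇒≱ p<z (maximal (⊑-trans y⊑p (proj₁ p<z) , z<x)))

    <⇔succ⊑ : ∀ {l z} → l < z ⇔ (∃[ s ] (IsSucc O l s × s ⊑ z))
    <⇔succ⊑ = mk⇔ succ-exists (λ (s , (l<s , _) , s⊑z) → <-≤-trans l<s s⊑z)

    <⇔⊑pred : ∀ {z r} → z < r ⇔ (∃[ p ] (IsSucc O p r × z ⊑ p))
    <⇔⊑pred = mk⇔ pred-exists (λ (p , (p<r , _) , z⊑p) → ≤-<-trans z⊑p p<r)

    open≐[+1‥-1] : ∀ {l r} → Open (just l) (just r) ≐ [_+1‥_-1] O l r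
    open≐[+1‥-1] =
      (λ (l<z , z<r) → let s , l→s , s⊑z = to <⇔succ⊑ l<z
                           p , p→r , z⊑p = to <⇔⊑pred z<r
                       in s , p , l→s , p→r , s⊑z , z⊑p) ,
      (λ (s , p , l→s , p→r , s⊑z , z⊑p) →
        from <⇔succ⊑ (s , l→s , s⊑z) , from <⇔⊑pred (p , p→r , z⊑p))

    open≐⟨←‥-1] : ∀ {r} → Open nothing (just r) ≐ ⟨←‥_-1] O r
    open≐⟨←‥-1] = (λ (_ , z<r) → to <⇔⊑pred z<r) , (λ z⊑pred → tt , from <⇔⊑pred z⊑pred)

    open≐[+1‥→⟩ : ∀ {l} → Open (just l) nothing ≐ [_+1‥→⟩ O l
    open≐[+1‥→⟩ = (λ (l<z , _) → to <⇔succ⊑ l<z) , (λ succ⊑z → from <⇔succ⊑ succ⊑z , tt)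

    lower-end : ∀ {I x} → IsInterval O I → I x → ∃[ lo ] (∀ {z} → z ⊑ x → (I z ⇔ Above lo z))
    lower-end {I} {x} I-int Ix with dec {∃[ z ] (z ⊑ x × ¬ I z)}
    ... | no ∄ =
      nothing , λ z⊑x → mk⇔ (λ _ → tt) (λ _ → decidable-stable dec (λ ¬Iz → ∄ (_ , z⊑x , ¬Iz)))
    ... | yes (z₀ , z₀⊑x , ¬Iz₀)
      with greatest {Q = λ w → z₀ ⊑ w × w ⊑ x × ¬ I w} (λ (z₀⊑w , w⊑x , _) → z₀⊑w , w⊑x)
                    (⊑-refl , z₀⊑x , ¬Iz₀)
    ... | p , (z₀⊑p , p⊑x , ¬Ip) , maximal =
      just p , λ z⊑x → mk⇔ (inside⇒above z⊑x) (above⇒inside z⊑x)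
      where
      inside⇒above : ∀ {z} → z ⊑ x → I z → p < z
      inside⇒above {z} z⊑x Iz with ⊑⊎> z p
      ... | inj₁ z⊑p = ⊥-elim (¬Ip (I-int z p x Iz Ix z⊑p p⊑x))
      ... | inj₂ p<z = p<z

      above⇒inside : ∀ {z} → z ⊑ x → p < z → I z
      above⇒inside z⊑x p<z =
        decidable-stable dec (λ ¬Iz → <⇒≱ p<z (maximal (⊑-trans z₀⊑p (proj₁ p<z) , z⊑x , ¬Iz)))

    upper-end : ∀ {I x} → IsInterval O I → I x → ∃[ hi ] (∀ {z} → x ⊑ z → (I z ⇔ Below hi z))
    upper-end {I} {x} I-int Ix with dec {∃[ z ] (x ⊑ z × ¬ I z)}
    ... | no ∄ =
      nothing , λ x⊑z → mk⇔ (λ _ → tt) (λ _ → decidable-stable dec (λ ¬Iz → ∄ (_ , x⊑z , ¬Iz)))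
    ... | yes (z₀ , x⊑z₀ , ¬Iz₀)
      with least {Q = λ w → x ⊑ w × w ⊑ z₀ × ¬ I w} (λ (x⊑w , w⊑z₀ , _) → x⊑w , w⊑z₀)
                 (x⊑z₀ , ⊑-refl , ¬Iz₀)
    ... | q , (x⊑q , q⊑z₀ , ¬Iq) , minimal =
      just q , λ x⊑z → mk⇔ (inside⇒below x⊑z) (below⇒inside x⊑z)
      where
      inside⇒below : ∀ {z} → x ⊑ z → I z → z < q
      inside⇒below {z} x⊑z Iz with ⊑⊎> q z
      ... | inj₁ q⊑z = ⊥-elim (¬Iq (I-int x q z Ix Iz x⊑q q⊑z))
      ... | inj₂ z<q = z<q

      below⇒inside : ∀ {z} → x ⊑ z → z < q → I z
      below⇒inside x⊑z z<q =
        decidable-stable dec (λ ¬Iz → <⇒≱ z<q (minimal (x⊑z , ⊑-trans (proj₁ z<q) q⊑z₀ , ¬Iz)))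

    interval≐open : ∀ {I x} → IsInterval O I → I x → ∃[ lo ] ∃[ hi ] (I ≐ Open lo hi)
    interval≐open {I} {x} I-int Ix with lower-end I-int Ix | upper-end I-int Ix
    ... | lo , lower-part | hi , upper-part = lo , hi , I⊆open , open⊆I
      where
      I⊆open : I ⊆ Open lo hi
      I⊆open {z} Iz with total z x
      ... | inj₁ z⊑x = to (lower-part z⊑x) Iz , below-mono z⊑x (to (upper-part ⊑-refl) Ix)
      ... | inj₂ x⊑z = above-mono (to (lower-part ⊑-refl) Ix) x⊑z , to (upper-part x⊑z) Iz

      open⊆I : Open lo hi ⊆ I
      open⊆I {z} (lo<z , z<hi) with total z x
      ... | inj₁ z⊑x = from (lower-part z⊑x) lo<z
      ... | inj₂ x⊑z = from (upper-part x⊑z) z<hi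

    module CriticalGaps (A : Antichain O) where
      open Antichain A
      open Gaps A

      <-left⇒<-right : ∀ {l r l' r'} → ⟦ l , r ⟧ ∈A → ⟦ l' , r' ⟧ ∈A → l < l' → r < r'
      <-left⇒<-right {r = r} {r' = r'} lr∈A lr'∈A l<l' with ⊑⊎> r' r
      ... | inj₁ r'⊑r = ⊥-elim (<-irrefl (sym (proj₁ (nested-≡ lr'∈A lr∈A (proj₁ l<l') r'⊑r))) l<l')
      ... | inj₂ r<r' = r<r'

      enlargement-⊇-member : ∀ {I S : Subset O} → Critical O A I → IsInterval O S → I ⊆ S →
                             ∀ {y} → S y → ¬ I y →
                             ∃[ l ] ∃[ r ] (⟦ l , r ⟧ ∈A × [_‥_] O l r ⊆ S)
      enlargement-⊇-member {S = S} (_ , avoids , maximal) S-int I⊆S Sy ¬Iy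
        with dec {∃[ J ] (J ∈A × ⟪_⟫ O J ⊆ S)}
      ... | yes (∅ᶠ , ∅ᶠ∈A , _) = ⊥-elim (avoids⇒∅ᶠ∉A avoids ∅ᶠ∈A)
      ... | yes (⟦ l , r ⟧ , lr∈A , lr⊆S) = l , r , lr∈A , lr⊆S
      ... | no ∄ = ⊥-elim (¬Iy (maximal S S-int (λ J J∈A J⊆S → ∄ (J , J∈A , J⊆S)) I⊆S Sy))

      critical⇒leftEnd : ∀ {lo hi} → NonEmpty O A (Open lo hi) → Critical O A (Open lo hi) →
                         LeftEnd lo hi
      critical⇒leftEnd {nothing} _ _ = tt
      critical⇒leftEnd {just l} {hi} (x , l<x , x<hi) critical@(_ , avoids , _)
        with enlargement-⊇-member critical
               (∩-interval (upClosed⇒interval ⊑-trans) (downClosed⇒interval below-mono))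
               (λ (l<z , z<hi) → proj₁ l<z , z<hi)
               (⊑-refl , below-mono (proj₁ l<x) x<hi) (<-irrefl refl ∘ proj₁)
      ... | a , b , ab∈A , ab⊆S with member-ends ab∈A ab⊆S
      ... | (l⊑a , _) , (_ , b<hi) with ≡⊎< l⊑a
      ... | inj₁ refl = b , ab∈A , b<hi
      ... | inj₂ l<a = ⊥-elim (avoids _ ab∈A ([‥]⊆open l<a b<hi))

      critical⇒rightEnd : ∀ {lo hi} → NonEmpty O A (Open lo hi) → Critical O A (Open lo hi) →
                          RightEnd lo hi
      critical⇒rightEnd {hi = nothing} _ _ = tt
      critical⇒rightEnd {lo} {just r} (x , lo<x , x<r) critical@(_ , avoids , _)
        with enlargement-⊇-member critical
               (∩-interval (upClosed⇒interval above-mono) (downClosed⇒interval ⊑-trans))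
               (λ (lo<z , z<r) → lo<z , proj₁ z<r)
               (above-mono lo<x (proj₁ x<r) , ⊑-refl) (<-irrefl refl ∘ proj₂)
      ... | a , b , ab∈A , ab⊆S with member-ends ab∈A ab⊆S
      ... | (lo<a , _) , (_ , b⊑r) with ≡⊎< b⊑r
      ... | inj₁ refl = a , ab∈A , lo<a
      ... | inj₂ b<r = ⊥-elim (avoids _ ab∈A ([‥]⊆open lo<a b<r))

      leftEnd⇒above : ∀ {lo hi I'} → LeftEnd lo hi → NonEmpty O A (Open lo hi) →
                      IsInterval O I' → AvoidsA O A I' → Open lo hi ⊆ I' → I' ⊆ Above lo
      leftEnd⇒above {nothing} _ _ _ _ _ _ = tt
      leftEnd⇒above {just l} {hi} {I'} (r , lr∈A , r<hi) (x , l<x , x<hi) I'-int I'-avoids open⊆I' {z} I'z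
        with ⊑⊎> z l
      ... | inj₂ l<z = l<z
      ... | inj₁ z⊑l = ⊥-elim (I'-avoids _ lr∈A lr⊆I')
        where
        lr⊆I' : [_‥_] O l r ⊆ I'
        lr⊆I' {w} (l⊑w , w⊑r) with ⊑⊎> w x
        ... | inj₁ w⊑x = I'-int z w x I'z (open⊆I' (l<x , x<hi)) (⊑-trans z⊑l l⊑w) w⊑x
        ... | inj₂ x<w = open⊆I' (<-≤-trans l<x (proj₁ x<w) , below-mono w⊑r r<hi)

      rightEnd⇒below : ∀ {lo hi I'} → RightEnd lo hi → NonEmpty O A (Open lo hi) →
                       IsInterval O I' → AvoidsA O A I' → Open lo hi ⊆ I' → I' ⊆ Below hi
      rightEnd⇒below {hi = nothing} _ _ _ _ _ _ = tt
      rightEnd⇒below {lo} {just r} {I'} (l , lr∈A , lo<l) (x , lo<x , x<r) I'-int I'-avoids open⊆I' {z} I'z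
        with ⊑⊎> r z
      ... | inj₂ z<r = z<r
      ... | inj₁ r⊑z = ⊥-elim (I'-avoids _ lr∈A lr⊆I')
        where
        lr⊆I' : [_‥_] O l r ⊆ I'
        lr⊆I' {w} (l⊑w , w⊑r) with ⊑⊎> x w
        ... | inj₁ x⊑w = I'-int x w z (open⊆I' (lo<x , x<r)) I'z x⊑w (⊑-trans w⊑r r⊑z)
        ... | inj₂ w<x = open⊆I' (above-mono lo<l l⊑w , ≤-<-trans (proj₁ w<x) x<r)

      open-critical⇔gap : ∀ {lo hi} → NonEmpty O A (Open lo hi) → Critical O A (Open lo hi) ⇔ Gap lo hi
      open-critical⇔gap nonEmpty = mk⇔
        (λ critical@(_ , avoids , _) →
          critical⇒leftEnd nonEmpty critical , critical⇒rightEnd nonEmpty critical , avoids)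
        (λ (leftEnd , rightEnd , avoids) →
          open-interval , avoids ,
          λ I' I'-int I'-avoids open⊆I' I'z →
            leftEnd⇒above leftEnd nonEmpty I'-int I'-avoids open⊆I' I'z ,
            rightEnd⇒below rightEnd nonEmpty I'-int I'-avoids open⊆I' I'z)

      critical⇔gap : ∀ {I lo hi} → I ≐ Open lo hi → NonEmpty O A I → Critical O A I ⇔ Gap lo hi
      critical⇔gap I≐open@(I⊆open , _) (x , Ix) = mk⇔
        (λ critical → to gap⇔ (critical-resp-≐ I≐open critical))
        (λ gap → critical-resp-≐ (≐-sym I≐open) (from gap⇔ gap))
        where gap⇔ = open-critical⇔gap (x , I⊆open Ix)

      gap⇔succIn : ∀ {l r'} → Gap (just l) (just r') ⇔ (∃[ r ] ∃[ l' ] IsSuccIn O A l r l' r')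
      gap⇔succIn {l} {r'} = mk⇔ to′ from′
        where
        to′ : Gap (just l) (just r') → ∃[ r ] ∃[ l' ] IsSuccIn O A l r l' r'
        to′ ((r , lr∈A , _) , (l' , lr'∈A , l<l') , avoids) =
          r , l' , lr∈A , lr'∈A , l<l' ,
          λ a b ab∈A (l<a , a<l') → avoids _ ab∈A ([‥]⊆open l<a (<-left⇒<-right ab∈A lr'∈A a<l'))

        from′ : ∃[ r ] ∃[ l' ] IsSuccIn O A l r l' r' → Gap (just l) (just r')
        from′ (r , l' , lr∈A , lr'∈A , l<l' , nothing-between) =
          (r , lr∈A , <-left⇒<-right lr∈A lr'∈A l<l') , (l' , lr'∈A , l<l') ,
          avoids-open (member⇒∅ᶠ∉A lr∈A) no-member
          where
          no-member : ∀ {a b} → ⟦ a , b ⟧ ∈A → ¬ (l < a × b < r')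
          no-member {a} {b} ab∈A (l<a , b<r') with ⊑⊎> l' a
          ... | inj₁ l'⊑a = <-irrefl (proj₂ (nested-≡ ab∈A lr'∈A l'⊑a (proj₁ b<r'))) b<r'
          ... | inj₂ a<l' = nothing-between a b ab∈A (l<a , a<l')

      gap⇔first : ∀ {r} → Gap nothing (just r) ⇔ (∃[ l ] IsFirst O A l r)
      gap⇔first {r} = mk⇔ to′ from′
        where
        to′ : Gap nothing (just r) → ∃[ l ] IsFirst O A l r
        to′ (_ , (l , lr∈A , _) , avoids) = l , lr∈A , first
          where
          first : ∀ a b → ⟦ a , b ⟧ ∈A → l ⊑ a
          first a b ab∈A with ⊑⊎> l a
          ... | inj₁ l⊑a = l⊑a
          ... | inj₂ a<l = ⊥-elim (avoids _ ab∈A ([‥]⊆open tt (<-left⇒<-right ab∈A lr∈A a<l)))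

        from′ : ∃[ l ] IsFirst O A l r → Gap nothing (just r)
        from′ (l , lr∈A , first) =
          tt , (l , lr∈A , tt) ,
          avoids-open (member⇒∅ᶠ∉A lr∈A)
            (λ ab∈A (_ , b<r) → <-irrefl (proj₂ (nested-≡ ab∈A lr∈A (first _ _ ab∈A) (proj₁ b<r))) b<r)

      gap⇔last : ∀ {l} → Gap (just l) nothing ⇔ (∃[ r ] IsLast O A l r)
      gap⇔last {l} = mk⇔ to′ from′
        where
        to′ : Gap (just l) nothing → ∃[ r ] IsLast O A l r
        to′ ((r , lr∈A , _) , _ , avoids) = r , lr∈A , last
          where
          last : ∀ a b → ⟦ a , b ⟧ ∈A → a ⊑ l
          last a b ab∈A with ⊑⊎> a l
          ... | inj₁ a⊑l = a⊑l
          ... | inj₂ l<a = ⊥-elim (avoids _ ab∈A ([‥]⊆open l<a tt))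

        from′ : ∃[ r ] IsLast O A l r → Gap (just l) nothing
        from′ (r , lr∈A , last) =
          (r , lr∈A , tt) , tt ,
          avoids-open (member⇒∅ᶠ∉A lr∈A) (λ ab∈A (l<a , _) → <⇒≱ l<a (last _ _ ab∈A))

      critical-empty⇔isOneMinus : Critical O A (Empty O) ⇔ IsOneMinus O A
      critical-empty⇔isOneMinus = mk⇔ to′ from′
        where
        to′ : Critical O A (Empty O) → IsOneMinus O A
        to′ critical@(_ , avoids , _) = isOneMinus
          where
          singleton∈A : ∀ x → ⟦ x , x ⟧ ∈A
          singleton∈A x with enlargement-⊇-member critical [‥]-interval (λ ()) (⊑-refl , ⊑-refl) (λ ())
          ... | a , b , ab∈A , ab⊆x with member-ends ab∈A ab⊆x
          ... | (x⊑a , a⊑x) , (x⊑b , b⊑x) =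
            subst₂ (λ u v → ⟦ u , v ⟧ ∈A) (antisym a⊑x x⊑a) (antisym b⊑x x⊑b) ab∈A

          isOneMinus : IsOneMinus O A
          isOneMinus ∅ᶠ = (λ ∅ᶠ∈A → ⊥-elim (avoids⇒∅ᶠ∉A avoids ∅ᶠ∈A)) , (λ _ ())
          isOneMinus ⟦ a , b ⟧ =
            (λ ab∈A → a , cong (λ c → ⟦ a , c ⟧)
                            (sym (proj₂ (nested-≡ (singleton∈A a) ab∈A ⊑-refl (wellFormed a b ab∈A))))) ,
            (λ x ab≡xx → subst _∈A (sym ab≡xx) (singleton∈A x))

        from′ : IsOneMinus O A → Critical O A (Empty O)
        from′ isOneMinus = (λ _ _ _ ()) , avoids , maximal
          where
          avoids : AvoidsA O A (Empty O)
          avoids J J∈A J⊆∅ with proj₁ (isOneMinus J) J∈A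
          ... | _ , refl = J⊆∅ (⊑-refl , ⊑-refl)

          maximal : ∀ I' → IsInterval O I' → AvoidsA O A I' → Empty O ⊆ I' → I' ⊆ Empty O
          maximal I' _ I'-avoids _ {z} I'z =
            I'-avoids ⟦ z , z ⟧ (proj₂ (isOneMinus _) z refl)
              (λ (z⊑w , w⊑z) → subst I' (antisym z⊑w w⊑z) I'z)

      Cases : Subset O → Set
      Cases I = Case-i O A I ⊎ Case-ii O A I ⊎ Case-iii O A I ⊎ Case-iv O A I ⊎ Case-v O A I

      gap⇒cases : ∀ {I} lo hi → I ≐ Open lo hi → NonEmpty O A I → Gap lo hi → Cases I
      gap⇒cases (just l) (just r') I≐open nonEmpty gap with to gap⇔succIn gap
      ... | r , l' , succIn = inj₁ (l , r , l' , r' , succIn , ≐-trans I≐open open≐[+1‥-1] , nonEmpty)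
      gap⇒cases nothing (just r) I≐open nonEmpty gap with to gap⇔first gap
      ... | l , first = inj₂ (inj₁ (l , r , first , ≐-trans I≐open open≐⟨←‥-1] , nonEmpty))
      gap⇒cases (just l) nothing I≐open nonEmpty gap with to gap⇔last gap
      ... | r , last = inj₂ (inj₂ (inj₁ (l , r , last , ≐-trans I≐open open≐[+1‥→⟩ , nonEmpty)))
      gap⇒cases nothing nothing (_ , open⊆I) _ gap =
        inj₂ (inj₂ (inj₂ (inj₁ (((λ _ → tt) , (λ _ → open⊆I (tt , tt))) , gap⇒isZero gap))))

      critical⇒cases : ∀ {I} → IsInterval O I → Critical O A I → Cases I
      critical⇒cases {I} I-int critical with dec {NonEmpty O A I}
      ... | no empty =
        inj₂ (inj₂ (inj₂ (inj₂ (I≐∅ , to critical-empty⇔isOneMinus (critical-resp-≐ I≐∅ critical)))))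
        where
        I≐∅ : I ≐ Empty O
        I≐∅ = (λ Ix → empty (_ , Ix)) , λ ()
      ... | yes nonEmpty@(_ , Ix) with interval≐open I-int Ix
      ... | lo , hi , I≐open =
        gap⇒cases lo hi I≐open nonEmpty (to (critical⇔gap I≐open nonEmpty) critical)

      cases⇒critical : ∀ {I} → Cases I → Critical O A I
      cases⇒critical (inj₁ (l , r , l' , r' , succIn , I≐ , nonEmpty)) =
        from (critical⇔gap (≐-trans I≐ (≐-sym open≐[+1‥-1])) nonEmpty)
             (from gap⇔succIn (r , l' , succIn))
      cases⇒critical (inj₂ (inj₁ (l , r , first , I≐ , nonEmpty))) =
        from (critical⇔gap (≐-trans I≐ (≐-sym open≐⟨←‥-1])) nonEmpty) (from gap⇔first (l , first))
      cases⇒critical (inj₂ (inj₂ (inj₁ (l , r , last , I≐ , nonEmpty)))) =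
        from (critical⇔gap (≐-trans I≐ (≐-sym open≐[+1‥→⟩)) nonEmpty) (from gap⇔last (r , last))
      cases⇒critical (inj₂ (inj₂ (inj₂ (inj₁ (I≐whole , zero))))) =
        critical-resp-≐ (≐-sym I≐whole) (critical-whole zero)
      cases⇒critical (inj₂ (inj₂ (inj₂ (inj₂ (I≐∅ , oneMinus))))) =
        critical-resp-≐ (≐-sym I≐∅) (from critical-empty⇔isOneMinus oneMinus)

theorem17 : ExcludedMiddle (suc 0ℓ) →
    (O : LFTO) → (A : Antichain O) → (I : Subset O) →
    IsInterval O I →
    Critical O A I ⇔
    (Case-i O A I ⊎ Case-ii O A I ⊎ Case-iii O A I ⊎ Case-iv O A I ⊎ Case-v O A I)
theorem17 em O A I I-int = mk⇔ (critical⇒cases I-int) cases⇒critical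
  where open Intervals.Classical.CriticalGaps O em A
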